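{- Let $M$ be a matroid on a finite set $E$. Let $A$ be a cyclic set of $M$ with $c(A)=c$ and let $Q$ be a circuit of $M$ with $Q\not\subseteq A$. Then for every $a\in A\cap Q$ there exists a cyclic set $A'$ of $M$ such that $a\notin A'\subseteq A\cup Q$ and $c(A')=c$.
   Context: A cyclic set of $M$ is a subset of $E$ that is a union of some circuits of $M$. For $A\subseteq E$, the cyclomaticity of $A$ is $c(A)=|A\setminus I|$, where $I$ is a maximal independent subset of $A$. -}

module Defs where

open import Data.Nat using (ℕ; _<_)
open import Data.Fin using (Fin)
open import Data.Fin.Subset
  using (Subset; _∈_; _∉_; _⊆_; _⊂_; _∪_; _─_; ⋃; ∣_∣; ⁅_⁆; ⊥)
open import Data.List using (List)
open import Data.List.Relation.Unary.All using (All)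
open import Data.Product using (Σ; ∃; _×_)
open import Relation.Nullary using (¬_)
open import Relation.Unary using (Decidable)
open import Relation.Binary.PropositionalEquality using (_≡_)
open import Level using (0ℓ; suc)

-- A matroid on the finite ground set E = Fin n, given by its independent sets
-- (axioms I1–I3). Independence is assumed decidable (automatic classically
-- for a finite ground set).
record Matroid (n : ℕ) : Set₁ where
  field
    Indep        : Subset n → Set
    indep?       : Decidable Indep
    indep-∅      : Indep ⊥
    indep-subset : ∀ {I J} → J ⊆ I → Indep I → Indep J
    indep-aug    : ∀ {I J} → Indep I → Indep J → ∣ I ∣ < ∣ J ∣ →
                   ∃ λ x → x ∈ J × x ∉ I × Indep (I ∪ ⁅ x ⁆)

module _ {n : ℕ} (M : Matroid n) where
  open Matroid M

  IsCircuit : Subset n → Set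
  IsCircuit C = ¬ Indep C × (∀ D → D ⊂ C → Indep D)

  IsCyclic : Subset n → Set
  IsCyclic A = Σ (List (Subset n)) λ Cs → All IsCircuit Cs × ⋃ Cs ≡ A

  MaxIndepIn : Subset n → Subset n → Set
  MaxIndepIn A I = I ⊆ A × Indep I × (∀ J → I ⊆ J → J ⊆ A → Indep J → J ≡ I)

  -- c(A) = c : |A \ I| = c for a maximal independent subset I of A
  -- (well defined, since all maximal independent subsets of A have the same size)
  Cyclomaticity : Subset n → ℕ → Set
  Cyclomaticity A c = ∃ λ I → MaxIndepIn A I × ∣ A ─ I ∣ ≡ c

{-# OPTIONS --safe #-}
-- Let C ⊆ A be a circuit through a. Extending C − a gives a basis I of A with a ∉ I, so
-- c = |A ─ I|. For q₀ ∈ Q ─ A the set I ∪ (Q ─ A) is dependent: augmenting Q − q₀ from it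
-- would give an independent K with |K| ≥ |I| + |Q ─ A|, although |K ∩ A| ≤ |I| and
-- K ─ A ⊆ (Q ─ A) − q₀. So a basis B of I ∪ (Q ─ A) extending I misses some q ∈ Q ─ A.
-- Every e of S = ((A ─ I) − a) ∪ {q} has a fundamental circuit in B ∪ {e}; their union Y
-- is cyclic, lies in B ∪ S ⊆ A ∪ Q, avoids a, and has basis Y ∩ B with Y ─ (Y ∩ B) = S,
-- whence c(Y) = |S| = |A ─ I| = c.
module Submission where

open import Defs
open import Data.Nat using (ℕ; suc; _+_; _≤_)
open import Data.Nat.Properties
  using (+-suc; +-comm; +-cancelʳ-≡; +-cancelˡ-≤; +-mono-≤; ≤-antisym; ≮⇒≥; 1+n≰n;
         module ≤-Reasoning)
open import Data.Fin using (Fin; zero)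
open import Data.Fin.Properties using (any?; _≟_)
open import Data.Fin.Subset
  using (Subset; inside; outside; _∈_; _∉_; _⊆_; _⊈_; _⊂_; _⊃_; _∩_; _∪_; _─_; _-_; ⋃; ∣_∣; ⁅_⁆)
open import Data.Fin.Subset.Properties
open import Data.Fin.Subset.Induction using (Acc; acc; ⊂-wellFounded; ⊃-wellFounded)
open import Data.Vec using ([]; _∷_; here; there)
open import Data.List using (List; []; _∷_; allFin)
open import Data.List.Membership.Propositional using () renaming (_∈_ to _∈ₗ_)
open import Data.List.Membership.Propositional.Properties using (∈-allFin)
open import Data.List.Relation.Unary.All as All using (All; []; _∷_)
open import Data.List.Relation.Unary.Any using (here; there)
open import Data.Product using (Σ; ∃; _×_; _,_; proj₁; proj₂; map; map₁; map₂)
open import Data.Sum using (inj₁; inj₂; [_,_]′)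
open import Function using (_∘_; id)
open import Relation.Nullary using (¬_; yes; no; contradiction)
open import Relation.Nullary.Decidable using (_×-dec_; ¬?; decidable-stable)
open import Relation.Binary.PropositionalEquality
  using (_≡_; refl; sym; trans; cong; subst; module ≡-Reasoning)

private variable
  n : ℕ
  x y : Fin n
  p q r s : Subset n
  ps : List (Subset n)

x∈p─q⁻ : ∀ (p q : Subset n) → x ∈ p ─ q → x ∈ p × x ∉ q
x∈p─q⁻ (inside  ∷ p) (outside ∷ q) here          = here , λ ()
x∈p─q⁻ (_       ∷ p) (_       ∷ q) (there x∈p─q) =
  map there (λ x∉q → x∉q ∘ drop-there) (x∈p─q⁻ p q x∈p─q)
x∈p─q⁻ {x = zero} (_       ∷ p) (inside  ∷ q) ()
x∈p─q⁻ {x = zero} (outside ∷ p) (outside ∷ q) ()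

x∈p⇒⁅x⁆⊆p : x ∈ p → ⁅ x ⁆ ⊆ p
x∈p⇒⁅x⁆⊆p {x = x} x∈p y∈⁅x⁆ = subst (_∈ _) (sym (x∈⁅y⁆⇒x≡y x y∈⁅x⁆)) x∈p

∪-lub : p ⊆ r → q ⊆ r → p ∪ q ⊆ r
∪-lub {p = p} {q = q} p⊆r q⊆r x∈p∪q = [ p⊆r , q⊆r ]′ (x∈p∪q⁻ p q x∈p∪q)

p⊂p∪⁅x⁆ : x ∉ p → p ⊂ p ∪ ⁅ x ⁆
p⊂p∪⁅x⁆ {x = x} {p = p} x∉p = p⊆p∪q ⁅ x ⁆ , x , q⊆p∪q p ⁅ x ⁆ (x∈⁅x⁆ x) , x∉p

p⊆q∧x∉p⇒p⊆q-x : p ⊆ q → x ∉ p → p ⊆ q - x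
p⊆q∧x∉p⇒p⊆q-x p⊆q x∉p y∈p = x∈p∧x≢y⇒x∈p-y (p⊆q y∈p) λ { refl → x∉p y∈p }

p⊆q∪⁅x⁆∧x∉p⇒p⊆q : p ⊆ q ∪ ⁅ x ⁆ → x ∉ p → p ⊆ q
p⊆q∪⁅x⁆∧x∉p⇒p⊆q {q = q} {x = x} p⊆q∪x x∉p y∈p =
  [ id , (λ y∈⁅x⁆ → contradiction (subst (_∈ _) (x∈⁅y⁆⇒x≡y x y∈⁅x⁆) y∈p) x∉p) ]′
    (x∈p∪q⁻ q ⁅ x ⁆ (p⊆q∪x y∈p))

p-x⊆q∧x∈q⇒p⊆q : p - x ⊆ q → x ∈ q → p ⊆ q
p-x⊆q∧x∈q⇒p⊆q {x = x} p-x⊆q x∈q {y} y∈p with y ≟ x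
... | yes refl = x∈q
... | no y≢x   = p-x⊆q (x∈p∧x≢y⇒x∈p-y y∈p y≢x)

p⊆q∧p⊆r∪s⇒p⊆q∩r∪s : p ⊆ q → p ⊆ r ∪ s → p ⊆ (q ∩ r) ∪ s
p⊆q∧p⊆r∪s⇒p⊆q∩r∪s {r = r} {s = s} p⊆q p⊆r∪s x∈p =
  [ (λ x∈r → p⊆p∪q s (x∈p∩q⁺ (p⊆q x∈p , x∈r))) , q⊆p∪q _ s ]′ (x∈p∪q⁻ r s (p⊆r∪s x∈p))

p⊈q⇒∃x∈p∧x∉q : p ⊈ q → ∃ λ x → x ∈ p × x ∉ q
p⊈q⇒∃x∈p∧x∉q {p = p} {q = q} p⊈q with any? (λ x → x ∈? p ×-dec ¬? (x ∈? q))
... | yes witness = witness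
... | no ∄ = contradiction (λ {x} x∈p → decidable-stable (x ∈? q) λ x∉q → ∄ (x , x∈p , x∉q)) p⊈q

∣p∪q∣≡∣p∣+∣q∣ : ∀ (p q : Subset n) → (∀ {x} → x ∈ p → x ∉ q) → ∣ p ∪ q ∣ ≡ ∣ p ∣ + ∣ q ∣
∣p∪q∣≡∣p∣+∣q∣ []            []            _        = refl
∣p∪q∣≡∣p∣+∣q∣ (inside  ∷ p) (inside  ∷ q) disjoint = contradiction here (disjoint here)
∣p∪q∣≡∣p∣+∣q∣ (inside  ∷ p) (outside ∷ q) disjoint =
  cong suc (∣p∪q∣≡∣p∣+∣q∣ p q λ x∈p x∈q → disjoint (there x∈p) (there x∈q))
∣p∪q∣≡∣p∣+∣q∣ (outside ∷ p) (inside  ∷ q) disjoint =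
  trans (cong suc (∣p∪q∣≡∣p∣+∣q∣ p q λ x∈p x∈q → disjoint (there x∈p) (there x∈q)))
        (sym (+-suc ∣ p ∣ ∣ q ∣))
∣p∪q∣≡∣p∣+∣q∣ (outside ∷ p) (outside ∷ q) disjoint =
  ∣p∪q∣≡∣p∣+∣q∣ p q λ x∈p x∈q → disjoint (there x∈p) (there x∈q)

∣p∩q∣+∣p─q∣≡∣p∣ : ∀ (p q : Subset n) → ∣ p ∩ q ∣ + ∣ p ─ q ∣ ≡ ∣ p ∣
∣p∩q∣+∣p─q∣≡∣p∣ []            []            = refl
∣p∩q∣+∣p─q∣≡∣p∣ (inside  ∷ p) (inside  ∷ q) = cong suc (∣p∩q∣+∣p─q∣≡∣p∣ p q)
∣p∩q∣+∣p─q∣≡∣p∣ (inside  ∷ p) (outside ∷ q) =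
  trans (+-suc ∣ p ∩ q ∣ ∣ p ─ q ∣) (cong suc (∣p∩q∣+∣p─q∣≡∣p∣ p q))
∣p∩q∣+∣p─q∣≡∣p∣ (outside ∷ p) (inside  ∷ q) = ∣p∩q∣+∣p─q∣≡∣p∣ p q
∣p∩q∣+∣p─q∣≡∣p∣ (outside ∷ p) (outside ∷ q) = ∣p∩q∣+∣p─q∣≡∣p∣ p q

∣p─q∣+∣q∣≡∣p∣ : q ⊆ p → ∣ p ─ q ∣ + ∣ q ∣ ≡ ∣ p ∣
∣p─q∣+∣q∣≡∣p∣ {q = q} {p = p} q⊆p = begin
  ∣ p ─ q ∣ + ∣ q ∣      ≡⟨ +-comm ∣ p ─ q ∣ ∣ q ∣ ⟩
  ∣ q ∣ + ∣ p ─ q ∣      ≡⟨ cong (λ t → ∣ t ∣ + ∣ p ─ q ∣) (sym p∩q≡q) ⟩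
  ∣ p ∩ q ∣ + ∣ p ─ q ∣  ≡⟨ ∣p∩q∣+∣p─q∣≡∣p∣ p q ⟩
  ∣ p ∣                  ∎
  where
  open ≡-Reasoning
  p∩q≡q : p ∩ q ≡ q
  p∩q≡q = ⊆-antisym (p∩q⊆q p q) (λ x∈q → x∈p∩q⁺ (q⊆p x∈q , x∈q))

∣p∪⁅x⁆∣≡1+∣p∣ : x ∉ p → ∣ p ∪ ⁅ x ⁆ ∣ ≡ suc ∣ p ∣
∣p∪⁅x⁆∣≡1+∣p∣ {x = x} {p = p} x∉p = begin
  ∣ p ∪ ⁅ x ⁆ ∣      ≡⟨ ∣p∪q∣≡∣p∣+∣q∣ p ⁅ x ⁆ p-disjoint-⁅x⁆ ⟩
  ∣ p ∣ + ∣ ⁅ x ⁆ ∣  ≡⟨ cong (∣ p ∣ +_) (∣⁅x⁆∣≡1 x) ⟩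
  ∣ p ∣ + 1          ≡⟨ +-comm ∣ p ∣ 1 ⟩
  suc ∣ p ∣          ∎
  where
  open ≡-Reasoning
  p-disjoint-⁅x⁆ : y ∈ p → y ∉ ⁅ x ⁆
  p-disjoint-⁅x⁆ y∈p y∈⁅x⁆ = x∉p (subst (_∈ p) (x∈⁅y⁆⇒x≡y x y∈⁅x⁆) y∈p)

1+∣p-x∣≡∣p∣ : x ∈ p → suc ∣ p - x ∣ ≡ ∣ p ∣
1+∣p-x∣≡∣p∣ {x = x} {p = p} x∈p = begin
  suc ∣ p - x ∣          ≡⟨ +-comm 1 ∣ p - x ∣ ⟩
  ∣ p - x ∣ + 1          ≡⟨ cong (∣ p - x ∣ +_) (sym (∣⁅x⁆∣≡1 x)) ⟩
  ∣ p - x ∣ + ∣ ⁅ x ⁆ ∣  ≡⟨ ∣p─q∣+∣q∣≡∣p∣ (x∈p⇒⁅x⁆⊆p x∈p) ⟩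
  ∣ p ∣                  ∎
  where open ≡-Reasoning

x∈⋃⁻ : ∀ (ps : List (Subset n)) → x ∈ ⋃ ps → ∃ λ p → p ∈ₗ ps × x ∈ p
x∈⋃⁻ []       x∈⊥  = contradiction x∈⊥ ∉⊥
x∈⋃⁻ (p ∷ ps) x∈⋃ with x∈p∪q⁻ p (⋃ ps) x∈⋃
... | inj₁ x∈p   = p , here refl , x∈p
... | inj₂ x∈⋃ps = map₂ (map₁ there) (x∈⋃⁻ ps x∈⋃ps)

p∈ps⇒p⊆⋃ps : p ∈ₗ ps → p ⊆ ⋃ ps
p∈ps⇒p⊆⋃ps (here refl)                = p⊆p∪q _
p∈ps⇒p⊆⋃ps {ps = q ∷ ps} (there p∈ps) = q⊆p∪q q (⋃ ps) ∘ p∈ps⇒p⊆⋃ps p∈ps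

⋃-lub : All (_⊆ r) ps → ⋃ ps ⊆ r
⋃-lub []           = ⊥⊆
⋃-lub (p⊆r ∷ ps⊆r) = ∪-lub p⊆r (⋃-lub ps⊆r)

finite-choice : {A : Set} {P : Fin n → A → Set} (s : Subset n) →
                (∀ {x} → x ∈ s → Σ A (P x)) →
                Σ (List A) λ ts → All (λ t → ∃ λ x → x ∈ s × P x t) ts
                                × (∀ {x} → x ∈ s → ∃ λ t → t ∈ₗ ts × P x t)
finite-choice {n} {A} {P} s choose =
  map₂ (map₂ λ covers x∈s → covers x∈s (∈-allFin _)) (choose-along (allFin n))
  where
  choose-along : (xs : List (Fin n)) →
                 Σ (List A) λ ts → All (λ t → ∃ λ x → x ∈ s × P x t) ts
                                 × (∀ {x} → x ∈ s → x ∈ₗ xs → ∃ λ t → t ∈ₗ ts × P x t)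
  choose-along [] = [] , [] , λ _ ()
  choose-along (x ∷ xs) with ts , chosen , covers ← choose-along xs with x ∈? s
  ... | no x∉s = ts , chosen , λ where
    x∈s (here refl)  → contradiction x∈s x∉s
    x∈s (there x∈xs) → covers x∈s x∈xs
  ... | yes x∈s with t , Pxt ← choose x∈s = t ∷ ts , (x , x∈s , Pxt) ∷ chosen , λ where
    _   (here refl)  → t , here refl , Pxt
    y∈s (there y∈xs) → map₂ (map₁ there) (covers y∈s y∈xs)

module MatroidTheory {n : ℕ} (M : Matroid n) where
  open Matroid M

  private variable
    e a : Fin n
    A B C I J K L Q X Z : Subset n
    c : ℕ

  Basis : Subset n → Subset n → Set
  Basis Z B = B ⊆ Z × Indep B × (∀ e → e ∈ Z → e ∉ B → ¬ Indep (B ∪ ⁅ e ⁆))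

  maxIndepIn⇒basis : MaxIndepIn M Z B → Basis Z B
  maxIndepIn⇒basis {Z} {B} (B⊆Z , indB , maximal) = B⊆Z , indB , λ e e∈Z e∉B indB∪e →
    e∉B (subst (e ∈_) (maximal (B ∪ ⁅ e ⁆) (p⊆p∪q ⁅ e ⁆) (∪-lub B⊆Z (x∈p⇒⁅x⁆⊆p e∈Z)) indB∪e)
                      (q⊆p∪q B ⁅ e ⁆ (x∈⁅x⁆ e)))

  basis⇒maxIndepIn : Basis Z B → MaxIndepIn M Z B
  basis⇒maxIndepIn {Z} {B} (B⊆Z , indB , maximal) = B⊆Z , indB , λ J B⊆J J⊆Z indJ →
    ⊆-antisym (λ {e} e∈J → decidable-stable (e ∈? B) λ e∉B →
                 maximal e (J⊆Z e∈J) e∉B (indep-subset (∪-lub B⊆J (x∈p⇒⁅x⁆⊆p e∈J)) indJ))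
              B⊆J

  ∣indep∣≤∣basis∣ : Basis Z B → Indep L → L ⊆ Z → ∣ L ∣ ≤ ∣ B ∣
  ∣indep∣≤∣basis∣ (_ , indB , maximal) indL L⊆Z = ≮⇒≥ λ ∣B∣<∣L∣ →
    let (e , e∈L , e∉B , indB∪e) = indep-aug indB indL ∣B∣<∣L∣
    in  maximal e (L⊆Z e∈L) e∉B indB∪e

  ∣basis∣≡∣basis∣ : Basis Z B → Basis Z I → ∣ B ∣ ≡ ∣ I ∣
  ∣basis∣≡∣basis∣ basisB@(B⊆Z , indB , _) basisI@(I⊆Z , indI , _) =
    ≤-antisym (∣indep∣≤∣basis∣ basisI indB B⊆Z) (∣indep∣≤∣basis∣ basisB indI I⊆Z)

  basis-cyclomaticity : Cyclomaticity M Z c → Basis Z B → ∣ Z ─ B ∣ ≡ c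
  basis-cyclomaticity {Z} {B = B} (B₀ , maxB₀@(B₀⊆Z , _ , _) , refl) basisB@(B⊆Z , _ , _) =
    +-cancelʳ-≡ ∣ B ∣ _ _ (begin
      ∣ Z ─ B ∣ + ∣ B ∣    ≡⟨ ∣p─q∣+∣q∣≡∣p∣ B⊆Z ⟩
      ∣ Z ∣                ≡⟨ sym (∣p─q∣+∣q∣≡∣p∣ B₀⊆Z) ⟩
      ∣ Z ─ B₀ ∣ + ∣ B₀ ∣  ≡⟨ cong (∣ Z ─ B₀ ∣ +_) (∣basis∣≡∣basis∣ basisB₀ basisB) ⟩
      ∣ Z ─ B₀ ∣ + ∣ B ∣   ∎)
    where
    open ≡-Reasoning
    basisB₀ = maxIndepIn⇒basis maxB₀

  basis-extension : Indep I → I ⊆ Z → ∃ λ B → I ⊆ B × Basis Z B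
  basis-extension {I} {Z} = grow (⊃-wellFounded I)
    where
    grow : ∀ {B} → Acc _⊃_ B → Indep B → B ⊆ Z → ∃ λ B′ → B ⊆ B′ × Basis Z B′
    grow {B} (acc larger) indB B⊆Z
      with any? (λ e → e ∈? Z ×-dec ¬? (e ∈? B) ×-dec indep? (B ∪ ⁅ e ⁆))
    ... | no ¬extensible =
      B , ⊆-refl , B⊆Z , indB , λ e e∈Z e∉B indB∪e → ¬extensible (e , e∈Z , e∉B , indB∪e)
    ... | yes (e , e∈Z , e∉B , indB∪e) =
      map₂ (map₁ (⊆-trans (p⊆p∪q ⁅ e ⁆)))
           (grow (larger (p⊂p∪⁅x⁆ e∉B)) indB∪e (∪-lub B⊆Z (x∈p⇒⁅x⁆⊆p e∈Z)))

  augmentation : Indep K → Indep J → ∃ λ K′ → K ⊆ K′ × K′ ⊆ K ∪ J × Indep K′ × ∣ J ∣ ≤ ∣ K′ ∣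
  augmentation {K} {J} indK indJ
    with K′ , K⊆K′ , basis@(K′⊆K∪J , indK′ , _) ← basis-extension indK (p⊆p∪q J)
    = K′ , K⊆K′ , K′⊆K∪J , indK′ , ∣indep∣≤∣basis∣ basis indJ (q⊆p∪q K J)

  circuit⊆⇒dependent : IsCircuit M C → C ⊆ X → ¬ Indep X
  circuit⊆⇒dependent (depC , _) C⊆X indX = depC (indep-subset C⊆X indX)

  circuit-minus-indep : IsCircuit M C → e ∈ C → Indep (C - e)
  circuit-minus-indep (_ , minimal) e∈C = minimal _ (x∈p⇒p-x⊂p e∈C)

  dependent⇒circuit⊆ : ¬ Indep X → ∃ λ C → IsCircuit M C × C ⊆ X
  dependent⇒circuit⊆ {X} = shrink (⊂-wellFounded X)
    where
    shrink : ∀ {D} → Acc _⊂_ D → ¬ Indep D → ∃ λ C → IsCircuit M C × C ⊆ D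
    shrink {D} (acc smaller) depD with any? (λ e → e ∈? D ×-dec ¬? (indep? (D - e)))
    ... | yes (e , e∈D , depD-e) =
      let (C , circuit , C⊆D-e) = shrink (smaller (x∈p⇒p-x⊂p e∈D)) depD-e
      in  C , circuit , ⊆-trans C⊆D-e (p─q⊆p D ⁅ e ⁆)
    ... | no ¬shrinkable = D , (depD , minimal) , ⊆-refl
      where
      minimal : ∀ D′ → D′ ⊂ D → Indep D′
      minimal D′ (D′⊆D , e , e∈D , e∉D′) =
        indep-subset (p⊆q∧x∉p⇒p⊆q-x D′⊆D e∉D′)
                     (decidable-stable (indep? (D - e)) λ depD-e → ¬shrinkable (e , e∈D , depD-e))

  fundamental-circuit : Indep B → ¬ Indep (B ∪ ⁅ e ⁆) →
                        ∃ λ C → IsCircuit M C × e ∈ C × C ⊆ B ∪ ⁅ e ⁆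
  fundamental-circuit {B} {e} indB depB∪e with C , circuit , C⊆B∪e ← dependent⇒circuit⊆ depB∪e =
    C , circuit , e∈C , C⊆B∪e
    where
    e∈C : e ∈ C
    e∈C = decidable-stable (e ∈? C) λ e∉C →
      circuit⊆⇒dependent circuit (p⊆q∪⁅x⁆∧x∉p⇒p⊆q C⊆B∪e e∉C) indB

  cyclic⇒circuit∋ : IsCyclic M Z → e ∈ Z → ∃ λ C → IsCircuit M C × e ∈ C × C ⊆ Z
  cyclic⇒circuit∋ (Cs , circuits , refl) e∈Z with C , C∈Cs , e∈C ← x∈⋃⁻ Cs e∈Z =
    C , All.lookup circuits C∈Cs , e∈C , p∈ps⇒p⊆⋃ps C∈Cs

  cyclic⇒basis∌ : IsCyclic M Z → e ∈ Z → ∃ λ B → Basis Z B × e ∉ B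
  cyclic⇒basis∌ cyclicZ e∈Z
    with C , circuit , e∈C , C⊆Z ← cyclic⇒circuit∋ cyclicZ e∈Z
    with B , C-e⊆B , basis@(_ , indB , _) ←
           basis-extension (circuit-minus-indep circuit e∈C) (⊆-trans (p─q⊆p C _) C⊆Z)
    = B , basis , λ e∈B → circuit⊆⇒dependent circuit (p-x⊆q∧x∈q⇒p⊆q C-e⊆B e∈B) indB

  ⋃-fundamental-circuits : ∀ {S} → Indep B → (∀ {e} → e ∈ S → ¬ Indep (B ∪ ⁅ e ⁆)) →
                           ∃ λ Y → IsCyclic M Y × Y ⊆ B ∪ S × Cyclomaticity M Y ∣ S ∣
  ⋃-fundamental-circuits {B} {S} indB dependent
    with Cs , fundamental , covering ←
           finite-choice S (λ e∈S → fundamental-circuit indB (dependent e∈S))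
    = Y , (Cs , All.map (proj₁ ∘ proj₂ ∘ proj₂) fundamental , refl) , Y⊆B∪S
        , Y ∩ B , basis⇒maxIndepIn basis , cong ∣_∣ Y─[Y∩B]≡S
    where
    Y : Subset n
    Y = ⋃ Cs

    e∈S⇒e∉B : e ∈ S → e ∉ B
    e∈S⇒e∉B e∈S e∈B = dependent e∈S (indep-subset (∪-lub ⊆-refl (x∈p⇒⁅x⁆⊆p e∈B)) indB)

    Y⊆B∪S : Y ⊆ B ∪ S
    Y⊆B∪S = ⋃-lub (All.map fundamental⊆B∪S fundamental)
      where
      fundamental⊆B∪S : (∃ λ e → e ∈ S × IsCircuit M C × e ∈ C × C ⊆ B ∪ ⁅ e ⁆) → C ⊆ B ∪ S
      fundamental⊆B∪S (e , e∈S , _ , _ , C⊆B∪e) =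
        ⊆-trans C⊆B∪e (∪-lub (p⊆p∪q S) (⊆-trans (x∈p⇒⁅x⁆⊆p e∈S) (q⊆p∪q B S)))

    Y∖[Y∩B]⊆S : e ∈ Y → e ∉ Y ∩ B → e ∈ S
    Y∖[Y∩B]⊆S e∈Y e∉Y∩B =
      [ (λ e∈B → contradiction (x∈p∩q⁺ (e∈Y , e∈B)) e∉Y∩B) , id ]′ (x∈p∪q⁻ B S (Y⊆B∪S e∈Y))

    S⊆Y : S ⊆ Y
    S⊆Y e∈S with C , C∈Cs , _ , e∈C , _ ← covering e∈S = p∈ps⇒p⊆⋃ps C∈Cs e∈C

    basis : Basis Y (Y ∩ B)
    basis = p∩q⊆p Y B , indep-subset (p∩q⊆q Y B) indB , λ e e∈Y e∉Y∩B →
      let (C , C∈Cs , circuit , _ , C⊆B∪e) = covering (Y∖[Y∩B]⊆S e∈Y e∉Y∩B)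
      in  circuit⊆⇒dependent circuit (p⊆q∧p⊆r∪s⇒p⊆q∩r∪s (p∈ps⇒p⊆⋃ps C∈Cs) C⊆B∪e)

    Y─[Y∩B]≡S : Y ─ (Y ∩ B) ≡ S
    Y─[Y∩B]≡S = ⊆-antisym
      (λ e∈Y─Y∩B → let (e∈Y , e∉Y∩B) = x∈p─q⁻ Y (Y ∩ B) e∈Y─Y∩B in Y∖[Y∩B]⊆S e∈Y e∉Y∩B)
      (λ e∈S → x∈p∧x∉q⇒x∈p─q (S⊆Y e∈S) (e∈S⇒e∉B e∈S ∘ proj₂ ∘ x∈p∩q⁻ Y B))

  basis∪[circuit─Z]-dependent : Basis Z I → IsCircuit M Q → e ∈ Q → e ∉ Z → ¬ Indep (I ∪ (Q ─ Z))
  basis∪[circuit─Z]-dependent {Z} {I} {Q} {q} basisI@(I⊆Z , _ , _) circuitQ q∈Q q∉Z indJ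
    with K , Q-q⊆K , K⊆[Q-q]∪J , indK , ∣J∣≤∣K∣ ←
           augmentation (circuit-minus-indep circuitQ q∈Q) indJ
    = 1+n≰n (+-cancelˡ-≤ ∣ I ∣ _ _ (begin
        ∣ I ∣ + suc ∣ D - q ∣  ≡⟨ cong (∣ I ∣ +_) (1+∣p-x∣≡∣p∣ q∈D) ⟩
        ∣ I ∣ + ∣ D ∣          ≡⟨ sym (∣p∪q∣≡∣p∣+∣q∣ I D e∈I⇒e∉D) ⟩
        ∣ I ∪ D ∣              ≤⟨ ∣J∣≤∣K∣ ⟩
        ∣ K ∣                  ≡⟨ sym (∣p∩q∣+∣p─q∣≡∣p∣ K Z) ⟩
        ∣ K ∩ Z ∣ + ∣ K ─ Z ∣  ≤⟨ +-mono-≤ ∣K∩Z∣≤∣I∣ (p⊆q⇒∣p∣≤∣q∣ K─Z⊆D-q) ⟩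
        ∣ I ∣ + ∣ D - q ∣      ∎))
    where
    open ≤-Reasoning
    D : Subset n
    D = Q ─ Z

    q∈D : q ∈ D
    q∈D = x∈p∧x∉q⇒x∈p─q q∈Q q∉Z

    e∈I⇒e∉D : e ∈ I → e ∉ D
    e∈I⇒e∉D e∈I e∈D = proj₂ (x∈p─q⁻ Q Z e∈D) (I⊆Z e∈I)

    ∣K∩Z∣≤∣I∣ : ∣ K ∩ Z ∣ ≤ ∣ I ∣
    ∣K∩Z∣≤∣I∣ = ∣indep∣≤∣basis∣ basisI (indep-subset (p∩q⊆p K Z) indK) (p∩q⊆q K Z)

    q∉K : q ∉ K
    q∉K q∈K = circuit⊆⇒dependent circuitQ (p-x⊆q∧x∈q⇒p⊆q Q-q⊆K q∈K) indK

    K─Z⊆D : K ─ Z ⊆ D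
    K─Z⊆D e∈K─Z with e∈K , e∉Z ← x∈p─q⁻ K Z e∈K─Z with x∈p∪q⁻ (Q - q) (I ∪ D) (K⊆[Q-q]∪J e∈K)
    ... | inj₁ e∈Q-q = x∈p∧x∉q⇒x∈p─q (p─q⊆p Q ⁅ q ⁆ e∈Q-q) e∉Z
    ... | inj₂ e∈I∪D = [ (λ e∈I → contradiction (I⊆Z e∈I) e∉Z) , id ]′ (x∈p∪q⁻ I D e∈I∪D)

    K─Z⊆D-q : K ─ Z ⊆ D - q
    K─Z⊆D-q = p⊆q∧x∉p⇒p⊆q-x K─Z⊆D (q∉K ∘ p─q⊆p K Z)

  extension-with-dependent-element : Basis A I → IsCircuit M Q → Q ⊈ A →
                        ∃ λ B → ∃ λ q → I ⊆ B × B ⊆ I ∪ (Q ─ A) × Indep B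
                                      × q ∈ Q ─ A × ¬ Indep (B ∪ ⁅ q ⁆)
  extension-with-dependent-element {A} {I} {Q} basisI@(_ , indI , _) circuitQ Q⊈A
    with q₀ , q₀∈Q , q₀∉A ← p⊈q⇒∃x∈p∧x∉q Q⊈A
    with B , I⊆B , B⊆J , indB , maximalB ← basis-extension indI (p⊆p∪q (Q ─ A))
    with q , q∈J , q∉B ← p⊈q⇒∃x∈p∧x∉q (λ J⊆B →
           basis∪[circuit─Z]-dependent basisI circuitQ q₀∈Q q₀∉A (indep-subset J⊆B indB))
    = B , q , I⊆B , B⊆J , indB
        , [ (λ q∈I → contradiction (I⊆B q∈I) q∉B) , id ]′ (x∈p∪q⁻ I (Q ─ A) q∈J)
        , maximalB q q∈J q∉B

  exchange : Basis A I → a ∈ A → a ∉ I → IsCircuit M Q → Q ⊈ A →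
             ∃ λ Y → IsCyclic M Y × a ∉ Y × Y ⊆ A ∪ Q × Cyclomaticity M Y ∣ A ─ I ∣
  exchange {A} {I} {a} {Q} basisI@(I⊆A , _ , maximalI) a∈A a∉I circuitQ Q⊈A
    with B , q , I⊆B , B⊆I∪[Q─A] , indB , q∈Q─A , depB∪q ←
           extension-with-dependent-element basisI circuitQ Q⊈A
    = let (Y , cyclicY , Y⊆B∪S , cY) = ⋃-fundamental-circuits indB S-dependent
      in  Y , cyclicY , a∉B∪S ∘ Y⊆B∪S , ⊆-trans Y⊆B∪S B∪S⊆A∪Q
            , subst (Cyclomaticity M Y) ∣S∣≡∣A─I∣ cY
    where
    S : Subset n
    S = ((A ─ I) - a) ∪ ⁅ q ⁆

    q∉A : q ∉ A
    q∉A = proj₂ (x∈p─q⁻ Q A q∈Q─A)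

    S-dependent : e ∈ S → ¬ Indep (B ∪ ⁅ e ⁆)
    S-dependent {e} e∈S with x∈p∪q⁻ ((A ─ I) - a) ⁅ q ⁆ e∈S
    ... | inj₁ e∈[A─I]-a =
      let (e∈A , e∉I) = x∈p─q⁻ A I (p─q⊆p (A ─ I) ⁅ a ⁆ e∈[A─I]-a)
      in  maximalI e e∈A e∉I ∘ indep-subset (∪-lub (⊆-trans I⊆B (p⊆p∪q ⁅ e ⁆)) (q⊆p∪q B ⁅ e ⁆))
    ... | inj₂ e∈⁅q⁆ rewrite x∈⁅y⁆⇒x≡y q e∈⁅q⁆ = depB∪q

    ∣S∣≡∣A─I∣ : ∣ S ∣ ≡ ∣ A ─ I ∣
    ∣S∣≡∣A─I∣ = trans (∣p∪⁅x⁆∣≡1+∣p∣ q∉[A─I]-a) (1+∣p-x∣≡∣p∣ (x∈p∧x∉q⇒x∈p─q a∈A a∉I))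
      where
      q∉[A─I]-a : q ∉ (A ─ I) - a
      q∉[A─I]-a = q∉A ∘ p─q⊆p A I ∘ p─q⊆p (A ─ I) ⁅ a ⁆

    a∉B∪S : a ∉ B ∪ S
    a∉B∪S a∈B∪S with x∈p∪q⁻ B S a∈B∪S
    ... | inj₁ a∈B = [ a∉I , (λ a∈Q─A → proj₂ (x∈p─q⁻ Q A a∈Q─A) a∈A) ]′
                       (x∈p∪q⁻ I (Q ─ A) (B⊆I∪[Q─A] a∈B))
    ... | inj₂ a∈S = [ (λ a∈[A─I]-a → proj₂ (x∈p─q⁻ (A ─ I) ⁅ a ⁆ a∈[A─I]-a) (x∈⁅x⁆ a))
                     , (λ a∈⁅q⁆ → q∉A (subst (_∈ A) (x∈⁅y⁆⇒x≡y q a∈⁅q⁆) a∈A)) ]′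
                       (x∈p∪q⁻ ((A ─ I) - a) ⁅ q ⁆ a∈S)

    B∪S⊆A∪Q : B ∪ S ⊆ A ∪ Q
    B∪S⊆A∪Q = ∪-lub (⊆-trans B⊆I∪[Q─A] (∪-lub I⊆A∪Q Q─A⊆A∪Q))
                    (∪-lub (⊆-trans (p─q⊆p (A ─ I) ⁅ a ⁆) (⊆-trans (p─q⊆p A I) (p⊆p∪q Q)))
                           (x∈p⇒⁅x⁆⊆p (Q─A⊆A∪Q q∈Q─A)))
      where
      I⊆A∪Q : I ⊆ A ∪ Q
      I⊆A∪Q = ⊆-trans I⊆A (p⊆p∪q Q)
      Q─A⊆A∪Q : Q ─ A ⊆ A ∪ Q
      Q─A⊆A∪Q = ⊆-trans (p─q⊆p Q A) (q⊆p∪q A Q)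

open MatroidTheory

claim3 : {n : ℕ} (M : Matroid n) (A Q : Subset n) (c : ℕ) →
    IsCyclic M A → Cyclomaticity M A c →
    IsCircuit M Q → Q ⊈ A →
    ∀ a → a ∈ A ∩ Q →
    Σ (Subset n) λ A′ → IsCyclic M A′ × a ∉ A′ × A′ ⊆ A ∪ Q × Cyclomaticity M A′ c
claim3 M A Q c cyclicA cA circuitQ Q⊈A a a∈A∩Q
  with a∈A , _ ← x∈p∩q⁻ A Q a∈A∩Q
  with I , basisI , a∉I ← cyclic⇒basis∌ M cyclicA a∈A
  with refl ← basis-cyclomaticity M cA basisI
  = exchange M basisI a∈A a∉I circuitQ Q⊈A
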